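{- Let $N$ be an RPN over a taxon set, and let $\bar N$ be its compression. Then: (1) if $N$ is binary and galled, then $\bar N$ is a tree; (2) if $N$ is reticulation-visible, then $\bar N$ is a tree-child network.
   Context: An RPN over a finite set $X$ of taxa is a finite acyclic directed graph $N$ with a unique node of indegree $0$ (the root, which has outdegree at least $1$), all edges directed away from the root, such that every non-root node has indegree $1$ or outdegree $1$, and the nodes of indegree $1$ and outdegree $0$ (leaves) are bijectively labelled by $X$. A non-leaf node of indegree at least $2$ (and outdegree $1$) is a reticulate node; a tree node is the root or a node of indegree $1$ and outdegree at least $2$; a redundant node has indegree $1$ and outdegree $1$. $\mathcal{T}(N),\mathcal{R}(N),\mathcal{D}(N),\mathcal{L}(N)$ denote tree nodes, reticulate nodes, redundant nodes, leaves. $N$ is binary if every reticulate node has indegree $2$ and every tree node has outdegree $2$ (redundant nodes allowed). A binary RPN is galled if every reticulate node $u$ has an ancestor $w$ that is a tree node such that there are two internally disjoint directed paths from $w$ to $u$ in which all nodes except $u$ are tree nodes. A node $x$ is a dominator of $y$ if $x$ is an ancestor of $y$ and every directed path from the root to $y$ contains $x$; $x$ is visible if it is a dominator of some leaf. $N$ is reticulation-visible if every reticulate node and every redundant node is visible. $N$ is tree-child if every non-leaf node has a child that is a leaf, a tree node or a redundant node. A tree here means an RPN in which every non-root node has indegree $1$. Tree-node components are the connected components of the subgraph induced by $\mathcal{T}(N)$; reticulation components are the connected components of the subgraph induced by $\mathcal{R}(N)$. The compression $\bar N$ of $N$ is the directed graph (an RPN over the same taxa, with node types determined by degrees in $\bar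 N$) whose node set is the set of all tree-node components and reticulation components (each a single node) together with $\mathcal{D}(N)\cup\mathcal{L}(N)$, and whose edges are: (a) every edge $(u,v)$ of $N$ with $u\in\mathcal{D}(N)$, $v\in\mathcal{D}(N)\cup\mathcal{L}(N)$; (b) $(x,v)$ for a component $x$ and $v\in\mathcal{D}(N)\cup\mathcal{L}(N)$ such that $N$ has an edge from some node of $x$ to $v$; (c) $(v,y)$ for $v\in\mathcal{D}(N)$ and a component $y$ such that $N$ has an edge from $v$ to some node of $y$; (d) $(x,y)$ for distinct components $x,y$ such that $N$ has an edge from a node of $x$ to a node of $y$. -}

module Defs where

open import Data.Nat using (ℕ; zero; suc; _≤_)
open import Data.Fin using (Fin)
open import Data.Bool using (Bool; true)
open import Data.List using (List; []; _∷_; length; filterᵇ; allFin)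
open import Data.List.Membership.Propositional using (_∈_)
open import Data.Product using (Σ; ∃; _×_; _,_)
open import Data.Sum using (_⊎_)
open import Relation.Nullary using (¬_)
open import Relation.Binary.PropositionalEquality using (_≡_; _≢_)
open import Relation.Binary.Construct.Closure.ReflexiveTransitive using (Star)

record Graph : Set where
  field
    n : ℕ
    E : Fin n → Fin n → Bool
open Graph public

module _ (G : Graph) where

  Edge : Fin (n G) → Fin (n G) → Set
  Edge u v = E G u v ≡ true

  indeg : Fin (n G) → ℕ
  indeg v = length (filterᵇ (λ u → E G u v) (allFin (n G)))

  outdeg : Fin (n G) → ℕ
  outdeg u = length (filterᵇ (λ v → E G u v) (allFin (n G)))

  data Path : Fin (n G) → Fin (n G) → Set where
    []  : ∀ {u} → Path u u
    _∷_ : ∀ {u v w} → Edge u v → Path v w → Path u w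

  nodes : ∀ {u w} → Path u w → List (Fin (n G))
  nodes {u} [] = u ∷ []
  nodes {u} (_ ∷ p) = u ∷ nodes p

  interior : ∀ {u w} → Path u w → List (Fin (n G))
  interior [] = []
  interior (_ ∷ []) = []
  interior (_∷_ {v = v} _ (e ∷ p)) = v ∷ interior (e ∷ p)

  Ancestor : Fin (n G) → Fin (n G) → Set
  Ancestor x y = Path x y

  Acyclic : Set
  Acyclic = ∀ {u v} → Edge u v → ¬ Path v u

  IsRoot : Fin (n G) → Set
  IsRoot v = indeg v ≡ 0

  IsLeaf : Fin (n G) → Set
  IsLeaf v = indeg v ≡ 1 × outdeg v ≡ 0

  IsTreeNode : Fin (n G) → Set
  IsTreeNode v = IsRoot v ⊎ (indeg v ≡ 1 × 2 ≤ outdeg v)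

  IsReticulate : Fin (n G) → Set
  IsReticulate v = 2 ≤ indeg v × outdeg v ≡ 1

  IsRedundant : Fin (n G) → Set
  IsRedundant v = indeg v ≡ 1 × outdeg v ≡ 1

  -- RPN over the taxon set X = Fin k, with leaf labelling ℓ
  record IsRPN {k : ℕ} (ℓ : Fin k → Fin (n G)) : Set where
    field
      acyclic   : Acyclic
      root      : Fin (n G)
      rootIn0   : IsRoot root
      rootOut   : 1 ≤ outdeg root
      rootUniq  : ∀ v → IsRoot v → v ≡ root
      nonRoot   : ∀ v → ¬ IsRoot v → indeg v ≡ 1 ⊎ outdeg v ≡ 1
      ℓ-inj     : ∀ i j → ℓ i ≡ ℓ j → i ≡ j
      ℓ-leaf    : ∀ i → IsLeaf (ℓ i)
      ℓ-onto    : ∀ v → IsLeaf v → ∃ λ i → ℓ i ≡ v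

  IsBinary : Set
  IsBinary = (∀ v → IsReticulate v → indeg v ≡ 2)
           × (∀ v → IsTreeNode v → outdeg v ≡ 2)

  -- two internally disjoint (and distinct) paths from w to u:
  -- no common interior node, and not both equal to the single edge (w,u)
  InternallyDisjoint : ∀ {w u} → Path w u → Path w u → Set
  InternallyDisjoint p q =
      (∀ x → x ∈ interior p → ¬ (x ∈ interior q))
    × ¬ (interior p ≡ [] × interior q ≡ [])

  TreeExceptEnd : ∀ {w u} → Path w u → Set
  TreeExceptEnd {w} p = IsTreeNode w × (∀ x → x ∈ interior p → IsTreeNode x)

  IsGalled : Set
  IsGalled = ∀ u → IsReticulate u →
    Σ (Fin (n G)) λ w → IsTreeNode w × Ancestor w u ×
      Σ (Path w u) λ p → Σ (Path w u) λ q →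
        InternallyDisjoint p q × TreeExceptEnd p × TreeExceptEnd q

  Dominator : Fin (n G) → Fin (n G) → Set
  Dominator x y = Ancestor x y ×
    (∀ r → IsRoot r → (p : Path r y) → x ∈ nodes p)

  Visible : Fin (n G) → Set
  Visible x = Σ (Fin (n G)) λ l → IsLeaf l × Dominator x l

  IsReticulationVisible : Set
  IsReticulationVisible = ∀ v → (IsReticulate v ⊎ IsRedundant v) → Visible v

  TreeChildProp : Set
  TreeChildProp = ∀ v → ¬ IsLeaf v →
    Σ (Fin (n G)) λ c → Edge v c × (IsLeaf c ⊎ IsTreeNode c ⊎ IsRedundant c)

  IsTreeChild : {k : ℕ} → (Fin k → Fin (n G)) → Set
  IsTreeChild ℓ = IsRPN ℓ × TreeChildProp

  IsTree : {k : ℕ} → (Fin k → Fin (n G)) → Set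
  IsTree ℓ = IsRPN ℓ × (∀ v → ¬ IsRoot v → indeg v ≡ 1)

  TStep : Fin (n G) → Fin (n G) → Set
  TStep u v = IsTreeNode u × IsTreeNode v × (Edge u v ⊎ Edge v u)

  RStep : Fin (n G) → Fin (n G) → Set
  RStep u v = IsReticulate u × IsReticulate v × (Edge u v ⊎ Edge v u)

  -- u and v become the same node of the compression
  SameClass : Fin (n G) → Fin (n G) → Set
  SameClass u v = u ≡ v ⊎ Star TStep u v ⊎ Star RStep u v

  -- A compression of G: a graph H together with the quotient map c,
  -- whose nodes are exactly the classes (tree-node components,
  -- reticulation components, singleton redundant nodes and leaves), and
  -- whose edges are exactly the images of edges of G joining distinct
  -- classes (this is precisely the union of rules (a)-(d)).
  record Compression : Set where
    field
      H        : Graph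
      c        : Fin (n G) → Fin (n H)
      c-onto   : ∀ a → ∃ λ u → c u ≡ a
      c-class  : ∀ u v → (c u ≡ c v → SameClass u v) × (SameClass u v → c u ≡ c v)
      c-edge   : ∀ a b → (E H a b ≡ true →
                           a ≢ b × Σ (Fin (n G)) λ u → Σ (Fin (n G)) λ v →
                             c u ≡ a × c v ≡ b × Edge u v)
                       × (a ≢ b × (Σ (Fin (n G)) λ u → Σ (Fin (n G)) λ v →
                             c u ≡ a × c v ≡ b × Edge u v) → E H a b ≡ true)

-- Tree nodes have one parent, so a tree-node component is an out-tree
-- entered only at its top; reticulate nodes have one child, so a
-- reticulation component is an in-tree left only at its bottom.  Hence the
-- compression is again an RPN (`compression-isRPN`).  (1) In a binary
-- galled network both parents of a reticulate node lie in one tree-node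
-- component, so every non-root class has in-degree 1.  (2) In a
-- reticulation-visible network a visible node above a reticulation
-- component dominates its exit, so it reaches the tail of every edge
-- entering the component; this gives redundant nodes a good child, and
-- lets a tree-node component find one by following escapes to ever higher
-- reticulation components (well-founded by acyclicity).
module Submission where

open import Defs
open import Data.Nat using (ℕ; zero; suc; _≤_; z≤n; s≤s; _≟_)
open import Data.Nat.Properties using (suc-injective; m≤n⇒m<n∨m≡n)
open import Data.Fin using (Fin; zero; suc)
import Data.Fin.Properties as Finₚ
open import Data.Fin.Induction using (spo-wellFounded; spo-noetherian)
open import Data.Bool using (Bool; true; false) renaming (_≟_ to _≟ᵇ_)
open import Data.List using ([]; _∷_; length; filterᵇ; allFin; tabulate)
open import Data.List.Membership.Propositional using (_∈_)
open import Data.List.Relation.Unary.Any using (here; there)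
open import Data.Product using (Σ; ∃; _×_; _,_; proj₁; proj₂)
open import Data.Sum using (_⊎_; inj₁; inj₂; [_,_]′)
open import Data.Empty using (⊥; ⊥-elim)
open import Relation.Nullary using (¬_; Dec; yes; no)
open import Relation.Binary.PropositionalEquality
open import Relation.Binary.Construct.Closure.ReflexiveTransitive using (Star; ε; _◅_)
open import Relation.Binary.Structures using (IsStrictPartialOrder)
open import Induction.WellFounded using (WellFounded; Acc; acc)
open import Function using (_∘_; id; case_of_)

count : ∀ {m} → (Fin m → Bool) → ℕ
count {zero}  f = 0
count {suc m} f with f zero
... | true  = suc (count (f ∘ suc))
... | false = count (f ∘ suc)

length-filter-tabulate : ∀ {A : Set} {m} (f : A → Bool) (g : Fin m → A) →
  length (filterᵇ f (tabulate g)) ≡ count (f ∘ g)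
length-filter-tabulate {m = zero}  f g = refl
length-filter-tabulate {m = suc m} f g with f (g zero)
... | true  = cong suc (length-filter-tabulate f (g ∘ suc))
... | false = length-filter-tabulate f (g ∘ suc)

length-filter-allFin : ∀ {m} (f : Fin m → Bool) → length (filterᵇ f (allFin m)) ≡ count f
length-filter-allFin f = length-filter-tabulate f id

count≡0⇒¬witness : ∀ {m} (f : Fin m → Bool) {x} → count f ≡ 0 → f x ≢ true
count≡0⇒¬witness {suc m} f {x} h fx with f zero in eq
count≡0⇒¬witness {suc m} f {x}     () fx | true
count≡0⇒¬witness {suc m} f {zero}  h  fx | false with () ← trans (sym eq) fx
count≡0⇒¬witness {suc m} f {suc x} h  fx | false = count≡0⇒¬witness (f ∘ suc) h fx

¬witness⇒count≡0 : ∀ {m} (f : Fin m → Bool) → (∀ x → f x ≢ true) → count f ≡ 0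
¬witness⇒count≡0 {zero}  f h = refl
¬witness⇒count≡0 {suc m} f h with f zero in eq
... | true  = ⊥-elim (h zero eq)
... | false = ¬witness⇒count≡0 (f ∘ suc) (h ∘ suc)

witness⇒1≤count : ∀ {m} (f : Fin m → Bool) {x} → f x ≡ true → 1 ≤ count f
witness⇒1≤count {suc m} f {x} fx with f zero in eq
witness⇒1≤count {suc m} f {x}     fx | true  = s≤s z≤n
witness⇒1≤count {suc m} f {zero}  fx | false with () ← trans (sym eq) fx
witness⇒1≤count {suc m} f {suc x} fx | false = witness⇒1≤count (f ∘ suc) fx

count≢0⇒witness : ∀ {m} (f : Fin m → Bool) → count f ≢ 0 → ∃ λ x → f x ≡ true
count≢0⇒witness {zero}  f h = ⊥-elim (h refl)
count≢0⇒witness {suc m} f h with f zero in eq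
... | true  = zero , eq
... | false with x , fx ← count≢0⇒witness (f ∘ suc) h = suc x , fx

unique⇒count≡1 : ∀ {m} (f : Fin m → Bool) {x} → f x ≡ true →
  (∀ y → f y ≡ true → y ≡ x) → count f ≡ 1
unique⇒count≡1 {suc m} f {x} fx h with f zero in eq
unique⇒count≡1 {suc m} f {zero}  fx h | true =
  cong suc (¬witness⇒count≡0 (f ∘ suc) λ y fy → case h (suc y) fy of λ ())
unique⇒count≡1 {suc m} f {suc x} fx h | true with () ← h zero eq
unique⇒count≡1 {suc m} f {zero}  fx h | false with () ← trans (sym eq) fx
unique⇒count≡1 {suc m} f {suc x} fx h | false =
  unique⇒count≡1 (f ∘ suc) fx λ y fy → Finₚ.suc-injective (h (suc y) fy)

count≡1⇒unique : ∀ {m} (f : Fin m → Bool) {x y} → count f ≡ 1 →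
  f x ≡ true → f y ≡ true → x ≡ y
count≡1⇒unique {suc m} f {x} {y} h fx fy with f zero in eq
... | true with x | y
...   | zero  | zero  = refl
...   | zero  | suc y = ⊥-elim (count≡0⇒¬witness (f ∘ suc) (suc-injective h) fy)
...   | suc x | _     = ⊥-elim (count≡0⇒¬witness (f ∘ suc) (suc-injective h) fx)
count≡1⇒unique {suc m} f {zero}  {y}     h fx fy | false with () ← trans (sym eq) fx
count≡1⇒unique {suc m} f {suc x} {zero}  h fx fy | false with () ← trans (sym eq) fy
count≡1⇒unique {suc m} f {suc x} {suc y} h fx fy | false =
  cong suc (count≡1⇒unique (f ∘ suc) h fx fy)

count≢1⇒otherWitness : ∀ {m} (f : Fin m → Bool) {x} → count f ≢ 1 → f x ≡ true →
  ∃ λ y → y ≢ x × f y ≡ true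
count≢1⇒otherWitness f {x} h fx with Finₚ.any? other?
  where
  other? : ∀ y → Dec (y ≢ x × f y ≡ true)
  other? y with y Finₚ.≟ x | f y ≟ᵇ true
  ... | yes y≡x | _        = no λ w → proj₁ w y≡x
  ... | no  y≢x | yes fy   = yes (y≢x , fy)
  ... | no  y≢x | no  ¬fy  = no λ w → ¬fy (proj₂ w)
... | yes w = w
... | no ¬w = ⊥-elim (h (unique⇒count≡1 f fx onlyX))
  where
  onlyX : ∀ y → f y ≡ true → y ≡ x
  onlyX y fy with y Finₚ.≟ x
  ... | yes y≡x = y≡x
  ... | no  y≢x = ⊥-elim (¬w (y , y≢x , fy))

count≡2⇒oneOf : ∀ {m} (f : Fin m → Bool) {x y z} → count f ≡ 2 → x ≢ y →
  f x ≡ true → f y ≡ true → f z ≡ true → z ≡ x ⊎ z ≡ y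
count≡2⇒oneOf {suc m} f {x} {y} {z} h x≢y fx fy fz with f zero in eq
... | true with x | y | z
...   | zero  | zero  | _     = ⊥-elim (x≢y refl)
...   | zero  | suc _ | zero  = inj₁ refl
...   | zero  | suc y | suc z = inj₂ (cong suc (count≡1⇒unique (f ∘ suc) (suc-injective h) fz fy))
...   | suc _ | zero  | zero  = inj₂ refl
...   | suc x | zero  | suc z = inj₁ (cong suc (count≡1⇒unique (f ∘ suc) (suc-injective h) fz fx))
...   | suc x | suc y | _     = ⊥-elim (x≢y (cong suc (count≡1⇒unique (f ∘ suc) (suc-injective h) fx fy)))
count≡2⇒oneOf {suc m} f {x} {y} {z} h x≢y fx fy fz | false with x | y | z
... | zero  | _     | _     with () ← trans (sym eq) fx
... | suc _ | zero  | _     with () ← trans (sym eq) fy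
... | suc _ | suc _ | zero  with () ← trans (sym eq) fz
... | suc x | suc y | suc z with count≡2⇒oneOf (f ∘ suc) h (x≢y ∘ cong suc) fx fy fz
...   | inj₁ z≡x = inj₁ (cong suc z≡x)
...   | inj₂ z≡y = inj₂ (cong suc z≡y)

star-target : ∀ {A : Set} {R : A → A → Set} {P : A → Set} {a b} →
  Star R a b → (∀ {x y} → R x y → P y) → a ≡ b ⊎ P b
star-target ε        f = inj₁ refl
star-target (r ◅ rs) f with star-target rs f
... | inj₁ refl = inj₂ (f r)
... | inj₂ pb   = inj₂ pb

star-source : ∀ {A : Set} {R : A → A → Set} {P : A → Set} {a b} →
  Star R a b → (∀ {x y} → R x y → P x) → a ≡ b ⊎ P a
star-source ε        f = inj₁ refl
star-source (r ◅ rs) f = inj₂ (f r)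

module Digraph (G : Graph) where

  V : Set
  V = Fin (n G)

  private
    indeg≡count : ∀ v → indeg G v ≡ count (λ u → E G u v)
    indeg≡count v = length-filter-allFin (λ u → E G u v)

    outdeg≡count : ∀ v → outdeg G v ≡ count (λ u → E G v u)
    outdeg≡count v = length-filter-allFin (λ u → E G v u)

  indeg≡0⇒noParent : ∀ {x v} → indeg G v ≡ 0 → ¬ Edge G x v
  indeg≡0⇒noParent {v = v} h = count≡0⇒¬witness (λ u → E G u v) (trans (sym (indeg≡count v)) h)

  outdeg≡0⇒noChild : ∀ {x v} → outdeg G v ≡ 0 → ¬ Edge G v x
  outdeg≡0⇒noChild {v = v} h = count≡0⇒¬witness (λ u → E G v u) (trans (sym (outdeg≡count v)) h)

  noParent⇒indeg≡0 : ∀ {v} → (∀ x → ¬ Edge G x v) → indeg G v ≡ 0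
  noParent⇒indeg≡0 {v} h = trans (indeg≡count v) (¬witness⇒count≡0 (λ u → E G u v) h)

  noChild⇒outdeg≡0 : ∀ {v} → (∀ x → ¬ Edge G v x) → outdeg G v ≡ 0
  noChild⇒outdeg≡0 {v} h = trans (outdeg≡count v) (¬witness⇒count≡0 (λ u → E G v u) h)

  child⇒1≤outdeg : ∀ {x v} → Edge G v x → 1 ≤ outdeg G v
  child⇒1≤outdeg {v = v} e = subst (1 ≤_) (sym (outdeg≡count v)) (witness⇒1≤count (λ u → E G v u) e)

  indeg≢0⇒parent : ∀ {v} → indeg G v ≢ 0 → ∃ λ x → Edge G x v
  indeg≢0⇒parent {v} h = count≢0⇒witness (λ u → E G u v) (h ∘ trans (indeg≡count v))

  outdeg≢0⇒child : ∀ {v} → outdeg G v ≢ 0 → ∃ λ x → Edge G v x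
  outdeg≢0⇒child {v} h = count≢0⇒witness (λ u → E G v u) (h ∘ trans (outdeg≡count v))

  indeg≡1⇒uniqueParent : ∀ {x y v} → indeg G v ≡ 1 → Edge G x v → Edge G y v → x ≡ y
  indeg≡1⇒uniqueParent {v = v} h = count≡1⇒unique (λ u → E G u v) (trans (sym (indeg≡count v)) h)

  outdeg≡1⇒uniqueChild : ∀ {x y v} → outdeg G v ≡ 1 → Edge G v x → Edge G v y → x ≡ y
  outdeg≡1⇒uniqueChild {v = v} h = count≡1⇒unique (λ u → E G v u) (trans (sym (outdeg≡count v)) h)

  uniqueParent⇒indeg≡1 : ∀ {x v} → Edge G x v → (∀ y → Edge G y v → y ≡ x) → indeg G v ≡ 1
  uniqueParent⇒indeg≡1 {v = v} e h = trans (indeg≡count v) (unique⇒count≡1 (λ u → E G u v) e h)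

  uniqueChild⇒outdeg≡1 : ∀ {x v} → Edge G v x → (∀ y → Edge G v y → y ≡ x) → outdeg G v ≡ 1
  uniqueChild⇒outdeg≡1 {v = v} e h = trans (outdeg≡count v) (unique⇒count≡1 (λ u → E G v u) e h)

  indeg≢1⇒otherParent : ∀ {x v} → indeg G v ≢ 1 → Edge G x v → ∃ λ y → y ≢ x × Edge G y v
  indeg≢1⇒otherParent {v = v} h = count≢1⇒otherWitness (λ u → E G u v) (h ∘ trans (indeg≡count v))

  indeg≡2⇒oneOf : ∀ {x y z v} → indeg G v ≡ 2 → x ≢ y →
    Edge G x v → Edge G y v → Edge G z v → z ≡ x ⊎ z ≡ y
  indeg≡2⇒oneOf {v = v} h = count≡2⇒oneOf (λ u → E G u v) (trans (sym (indeg≡count v)) h)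

  infixr 5 _++ₚ_
  _++ₚ_ : ∀ {u v w} → Path G u v → Path G v w → Path G u w
  []      ++ₚ q = q
  (e ∷ p) ++ₚ q = e ∷ (p ++ₚ q)

  snoc : ∀ {u v w} → Path G u v → Edge G v w → Path G u w
  snoc p e = p ++ₚ (e ∷ [])

  start∈ : ∀ {u w} (p : Path G u w) → u ∈ nodes G p
  start∈ []      = here refl
  start∈ (_ ∷ p) = here refl

  end∈ : ∀ {u w} (p : Path G u w) → w ∈ nodes G p
  end∈ []      = here refl
  end∈ (_ ∷ p) = there (end∈ p)

  ∈-++ₚ : ∀ {u v w x} (p : Path G u v) (q : Path G v w) →
    x ∈ nodes G (p ++ₚ q) → x ∈ nodes G p ⊎ x ∈ nodes G q
  ∈-++ₚ []      q m         = inj₂ m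
  ∈-++ₚ (e ∷ p) q (here eq) = inj₁ (here eq)
  ∈-++ₚ (e ∷ p) q (there m) with ∈-++ₚ p q m
  ... | inj₁ m′ = inj₁ (there m′)
  ... | inj₂ m′ = inj₂ m′

  prefix : ∀ {u w x} (p : Path G u w) → x ∈ nodes G p → Path G u x
  prefix []      (here refl) = []
  prefix (e ∷ p) (here refl) = []
  prefix (e ∷ p) (there m)   = e ∷ prefix p m

  suffix : ∀ {u w x} (p : Path G u w) → x ∈ nodes G p →
    Σ (Path G x w) λ q → ∀ y → y ∈ nodes G q → y ∈ nodes G p
  suffix []      (here refl) = [] , λ y m → m
  suffix (e ∷ p) (here refl) = (e ∷ p) , λ y m → m
  suffix (e ∷ p) (there m) with q , sub ← suffix p m = q , λ y m′ → there (sub y m′)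

  _⇝⁺_ : V → V → Set
  x ⇝⁺ y = Σ V λ m → Edge G x m × Path G m y

  interior⇒⇝⁺ : ∀ {u w x} (p : Path G u w) → x ∈ interior G p → u ⇝⁺ x
  interior⇒⇝⁺ (e ∷ (e′ ∷ p)) (here refl) = _ , e , []
  interior⇒⇝⁺ (e ∷ (e′ ∷ p)) (there m) with _ , e₂ , q ← interior⇒⇝⁺ (e′ ∷ p) m = _ , e , (e₂ ∷ q)

  -- In an acyclic digraph proper descent is a strict partial order on a
  -- finite set, hence well-founded in both directions.
  module Acyclicity (acyclic : Acyclic G) where

    path-antisym : ∀ {a b} → Path G a b → Path G b a → a ≡ b
    path-antisym []      q = refl
    path-antisym (e ∷ p) q = ⊥-elim (acyclic e (p ++ₚ q))

    ⇝⁺-irrefl : ∀ {a} → ¬ (a ⇝⁺ a)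
    ⇝⁺-irrefl (_ , e , p) = acyclic e p

    ⇝⁺-trans : ∀ {a b c} → a ⇝⁺ b → b ⇝⁺ c → a ⇝⁺ c
    ⇝⁺-trans (m , e , p) (m′ , e′ , q) = m , e , (p ++ₚ (e′ ∷ q))

    path⇒⇝⁺ : ∀ {a b} → Path G a b → a ≢ b → a ⇝⁺ b
    path⇒⇝⁺ []      a≢b = ⊥-elim (a≢b refl)
    path⇒⇝⁺ (e ∷ p) _   = _ , e , p

    interior≢start : ∀ {u w x} (p : Path G u w) → x ∈ interior G p → x ≢ u
    interior≢start p m refl = ⇝⁺-irrefl (interior⇒⇝⁺ p m)

    ⇝⁺-isStrictPartialOrder : IsStrictPartialOrder _≡_ _⇝⁺_
    ⇝⁺-isStrictPartialOrder = record
      { isEquivalence = isEquivalence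
      ; irrefl        = λ { refl → ⇝⁺-irrefl }
      ; trans         = ⇝⁺-trans
      ; <-resp-≈      = (λ { refl x → x }) , (λ { refl x → x })
      }

    ancestors-wf : WellFounded _⇝⁺_
    ancestors-wf = spo-wellFounded ⇝⁺-isStrictPartialOrder

    descendants-wf : WellFounded (λ x y → y ⇝⁺ x)
    descendants-wf = spo-noetherian ⇝⁺-isStrictPartialOrder

module RPNFacts {k : ℕ} (N : Graph) (ℓ : Fin k → Fin (n N)) (rpn : IsRPN N ℓ) where
  open IsRPN rpn
  open Digraph N
  open Acyclicity acyclic

  private
    2≰1 : ¬ (2 ≤ 1)
    2≰1 (s≤s ())

  data Kind (v : V) : Set where
    tree       : IsTreeNode N v   → Kind v
    reticulate : IsReticulate N v → Kind v
    leaf       : IsLeaf N v       → Kind v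
    redundant  : IsRedundant N v  → Kind v

  kind : ∀ v → Kind v
  kind v with indeg N v ≟ 0
  ... | yes in0 = tree (inj₁ in0)
  ... | no ¬in0 with nonRoot v ¬in0
  ...   | inj₁ in1 with outdeg N v in out
  ...     | zero        = leaf (in1 , out)
  ...     | suc zero    = redundant (in1 , out)
  ...     | suc (suc _) = tree (inj₂ (in1 , subst (2 ≤_) (sym out) (s≤s (s≤s z≤n))))
  kind v | no ¬in0 | inj₂ out1 with indeg N v in inn
  ...     | zero        = ⊥-elim (¬in0 refl)
  ...     | suc zero    = redundant (inn , out1)
  ...     | suc (suc _) = reticulate (subst (2 ≤_) (sym inn) (s≤s (s≤s z≤n)) , out1)

  tree⇒¬reticulate : ∀ {v} → IsTreeNode N v → ¬ IsReticulate N v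
  tree⇒¬reticulate (inj₁ in0)     (in2 , _)  = case subst (2 ≤_) in0 in2 of λ ()
  tree⇒¬reticulate (inj₂ (_ , o2)) (_ , out1) = 2≰1 (subst (2 ≤_) out1 o2)

  leaf⇒¬tree : ∀ {v} → IsLeaf N v → ¬ IsTreeNode N v
  leaf⇒¬tree (in1 , _)  (inj₁ in0)     = case trans (sym in1) in0 of λ ()
  leaf⇒¬tree (_ , out0) (inj₂ (_ , o2)) = case subst (2 ≤_) out0 o2 of λ ()

  leaf⇒¬reticulate : ∀ {v} → IsLeaf N v → ¬ IsReticulate N v
  leaf⇒¬reticulate (_ , out0) (_ , out1) = case trans (sym out1) out0 of λ ()

  leaf⇒¬redundant : ∀ {v} → IsLeaf N v → ¬ IsRedundant N v
  leaf⇒¬redundant (_ , out0) (_ , out1) = case trans (sym out1) out0 of λ ()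

  redundant⇒¬tree : ∀ {v} → IsRedundant N v → ¬ IsTreeNode N v
  redundant⇒¬tree (in1 , _)  (inj₁ in0)     = case trans (sym in1) in0 of λ ()
  redundant⇒¬tree (_ , out1) (inj₂ (_ , o2)) = 2≰1 (subst (2 ≤_) out1 o2)

  redundant⇒¬reticulate : ∀ {v} → IsRedundant N v → ¬ IsReticulate N v
  redundant⇒¬reticulate (in1 , _) (in2 , _) = 2≰1 (subst (2 ≤_) in1 in2)

  reticulate? : ∀ v → Dec (IsReticulate N v)
  reticulate? v with kind v
  ... | tree t       = no (tree⇒¬reticulate t)
  ... | reticulate r = yes r
  ... | leaf lf      = no (leaf⇒¬reticulate lf)
  ... | redundant rd = no (redundant⇒¬reticulate rd)

  root-isTree : IsTreeNode N root
  root-isTree = inj₁ rootIn0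

  tree-indeg≡1 : ∀ {x v} → IsTreeNode N v → Edge N x v → indeg N v ≡ 1
  tree-indeg≡1 (inj₁ in0)       e = ⊥-elim (indeg≡0⇒noParent in0 e)
  tree-indeg≡1 (inj₂ (in1 , _)) e = in1

  leaf-noChild : ∀ {v x} → IsLeaf N v → ¬ Edge N v x
  leaf-noChild (_ , out0) = outdeg≡0⇒noChild out0

  -- In an RPN every node of out-degree 0 is a leaf (the root has a child).
  outdeg≡0⇒leaf : ∀ y → outdeg N y ≡ 0 → IsLeaf N y
  outdeg≡0⇒leaf y out0 with indeg N y ≟ 0
  ... | yes in0 with refl ← rootUniq y in0 = case subst (1 ≤_) out0 rootOut of λ ()
  ... | no ¬in0 with nonRoot y ¬in0
  ...   | inj₁ in1  = in1 , out0
  ...   | inj₂ out1 = case trans (sym out1) out0 of λ ()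

  -- Every node is reachable from the root (walk up parents, which
  -- terminates by acyclicity) and reaches a leaf (walk down children).
  -- Only the existence of these paths matters, so the well-founded
  -- recursions are kept opaque.
  opaque
    fromRoot : ∀ y → Path N root y
    fromRoot y = go y (ancestors-wf y)
      where
      go : ∀ y → Acc _⇝⁺_ y → Path N root y
      go y (acc rec) with indeg N y ≟ 0
      ... | yes in0 = subst (Path N root) (sym (rootUniq y in0)) []
      ... | no ¬in0 with x , e ← indeg≢0⇒parent ¬in0 = snoc (go x (rec (y , e , []))) e

    toLeaf : ∀ y → Σ V λ l → IsLeaf N l × Path N y l
    toLeaf y = go y (descendants-wf y)
      where
      go : ∀ y → Acc (λ x y → y ⇝⁺ x) y → Σ V λ l → IsLeaf N l × Path N y l
      go y (acc rec) with outdeg N y ≟ 0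
      ... | yes out0 = y , outdeg≡0⇒leaf y out0 , []
      ... | no ¬out0 with outdeg≢0⇒child ¬out0
      ...   | m , e with go m (rec (m , e , []))
      ...     | l , lf , p = l , lf , (e ∷ p)

module CompressionFacts {k : ℕ} (N : Graph) (ℓ : Fin k → Fin (n N)) (rpn : IsRPN N ℓ)
                        (C : Compression N) where
  open IsRPN rpn
  open Compression C
  open Digraph N
  open Acyclicity acyclic
  open RPNFacts N ℓ rpn
  module Hᵍ = Digraph H

  class⇒same : ∀ {u v} → c u ≡ c v → SameClass N u v
  class⇒same {u} {v} = proj₁ (c-class u v)

  same⇒class : ∀ {u v} → SameClass N u v → c u ≡ c v
  same⇒class {u} {v} = proj₂ (c-class u v)

  Lone : V → Set
  Lone v = IsLeaf N v ⊎ IsRedundant N v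

  tree-class : ∀ {u v} → IsTreeNode N u → c u ≡ c v → Star (TStep N) u v
  tree-class t eq with class⇒same eq
  ... | inj₁ refl      = ε
  ... | inj₂ (inj₁ ts) = ts
  ... | inj₂ (inj₂ rs) with star-source rs proj₁
  ...   | inj₁ refl = ε
  ...   | inj₂ r    = ⊥-elim (tree⇒¬reticulate t r)

  reticulate-class : ∀ {u v} → IsReticulate N u → c u ≡ c v → Star (RStep N) u v
  reticulate-class r eq with class⇒same eq
  ... | inj₁ refl      = ε
  ... | inj₂ (inj₂ rs) = rs
  ... | inj₂ (inj₁ ts) with star-source ts proj₁
  ...   | inj₁ refl = ε
  ...   | inj₂ t    = ⊥-elim (tree⇒¬reticulate t r)

  lone-class : ∀ {v w} → Lone v → c v ≡ c w → v ≡ w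
  lone-class lone eq with class⇒same eq
  ... | inj₁ v≡w       = v≡w
  ... | inj₂ (inj₁ ts) = [ id , (λ t → ⊥-elim (¬tree lone t)) ]′ (star-source ts proj₁)
    where
    ¬tree : ∀ {v} → Lone v → ¬ IsTreeNode N v
    ¬tree (inj₁ lf) = leaf⇒¬tree lf
    ¬tree (inj₂ rd) = redundant⇒¬tree rd
  ... | inj₂ (inj₂ rs) = [ id , (λ r → ⊥-elim (¬ret lone r)) ]′ (star-source rs proj₁)
    where
    ¬ret : ∀ {v} → Lone v → ¬ IsReticulate N v
    ¬ret (inj₁ lf) = leaf⇒¬reticulate lf
    ¬ret (inj₂ rd) = redundant⇒¬reticulate rd

  leaf-class : ∀ {l v} → IsLeaf N l → c l ≡ c v → l ≡ v
  leaf-class lf = lone-class (inj₁ lf)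

  redundant-class : ∀ {u v} → IsRedundant N u → c u ≡ c v → u ≡ v
  redundant-class rd = lone-class (inj₂ rd)

  tree-classmate : ∀ {v w} → IsTreeNode N v → c v ≡ c w → IsTreeNode N w
  tree-classmate t eq with star-target (tree-class t eq) (proj₁ ∘ proj₂)
  ... | inj₁ refl = t
  ... | inj₂ t′   = t′

  reticulate-classmate : ∀ {v w} → IsReticulate N v → c v ≡ c w → IsReticulate N w
  reticulate-classmate r eq with star-target (reticulate-class r eq) (proj₁ ∘ proj₂)
  ... | inj₁ refl = r
  ... | inj₂ r′   = r′

  tree-edge⇒sameClass : ∀ {u v} → IsTreeNode N u → IsTreeNode N v → Edge N u v → c u ≡ c v
  tree-edge⇒sameClass tu tv e = same⇒class (inj₂ (inj₁ ((tu , tv , inj₁ e) ◅ ε)))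

  reticulate-edge⇒sameClass : ∀ {u v} → IsReticulate N u → IsReticulate N v → Edge N u v → c u ≡ c v
  reticulate-edge⇒sameClass ru rv e = same⇒class (inj₂ (inj₂ ((ru , rv , inj₁ e) ◅ ε)))

  Entry : V → Set
  Entry y = Σ V λ p → Edge N p y × c p ≢ c y

  Exit : V → Set
  Exit u = Σ V λ q → Edge N u q × c q ≢ c u

  data TreeWalk (y : V) : V → Set where
    stay : TreeWalk y y
    step : ∀ {w v} → TreeWalk y w → Edge N w v → IsTreeNode N w → TreeWalk y v

  treeWalk⇒path : ∀ {y v} → TreeWalk y v → Path N y v
  treeWalk⇒path stay         = []
  treeWalk⇒path (step p e _) = snoc (treeWalk⇒path p) e

  Top : V → Set
  Top y = IsTreeNode N y × (∀ p → Edge N p y → ¬ IsTreeNode N p)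

  -- A tree-node component is an out-tree hanging from its top: as tree
  -- nodes have at most one parent, every zigzag inside the component
  -- starting at a node below the top ends at a node below the top.
  treeWalk-extend : ∀ {y a b} → Top y → TreeWalk y a → Star (TStep N) a b → TreeWalk y b
  treeWalk-extend top w ε = w
  treeWalk-extend top w ((ta , _ , inj₁ e) ◅ zs) = treeWalk-extend top (step w e ta) zs
  treeWalk-extend top stay ((_ , tm , inj₂ e) ◅ zs) = ⊥-elim (proj₂ top _ e tm)
  treeWalk-extend {y} top (step w e′ _) ((ta , _ , inj₂ e) ◅ zs) =
    treeWalk-extend top (subst (TreeWalk y) (indeg≡1⇒uniqueParent (tree-indeg≡1 ta e) e′ e) w) zs

  top-unique : ∀ {u v} → Top v → TreeWalk u v → u ≡ v
  top-unique top stay         = refl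
  top-unique top (step _ e t) = ⊥-elim (proj₂ top _ e t)

  data ReticulateWalk : V → V → Set where
    stay : ∀ {y} → ReticulateWalk y y
    step : ∀ {a m y} → Edge N a m → IsReticulate N m → ReticulateWalk m y → ReticulateWalk a y

  reticulateWalk⇒path : ∀ {a y} → ReticulateWalk a y → Path N a y
  reticulateWalk⇒path stay         = []
  reticulateWalk⇒path (step e _ p) = e ∷ reticulateWalk⇒path p

  Bottom : V → Set
  Bottom y = IsReticulate N y × (∀ q → Edge N y q → ¬ IsReticulate N q)

  -- Dually, a reticulation component is an in-tree rooted at its bottom,
  -- since reticulate nodes have exactly one child.
  reticulateWalk-extend : ∀ {y a b} → Bottom y → Star (RStep N) a b →
    ReticulateWalk b y → ReticulateWalk a y
  reticulateWalk-extend bot ε w = w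
  reticulateWalk-extend bot ((_ , rm , inj₁ e) ◅ zs) w = step e rm (reticulateWalk-extend bot zs w)
  reticulateWalk-extend {y} bot ((ra , rm , inj₂ e) ◅ zs) w with reticulateWalk-extend bot zs w
  ... | stay           = ⊥-elim (proj₂ bot _ e ra)
  ... | step e′ _ rest = subst (λ z → ReticulateWalk z y) (outdeg≡1⇒uniqueChild (proj₂ rm) e′ e) rest

  bottom-unique : ∀ {u v} → Bottom u → ReticulateWalk u v → u ≡ v
  bottom-unique bot stay         = refl
  bottom-unique bot (step e r _) = ⊥-elim (proj₂ bot _ e r)

  entry⇒top : ∀ {y} → IsTreeNode N y → Entry y → Top y
  entry⇒top t (p , e , cp≢cy) = t , λ p′ e′ tp′ →
    cp≢cy (subst (λ z → c z ≡ _) (indeg≡1⇒uniqueParent (tree-indeg≡1 t e) e′ e)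
                 (tree-edge⇒sameClass tp′ t e′))

  exit⇒bottom : ∀ {u} → IsReticulate N u → Exit u → Bottom u
  exit⇒bottom r (q , e , cq≢cu) = r , λ q′ e′ rq′ →
    cq≢cu (sym (subst (λ z → _ ≡ c z) (outdeg≡1⇒uniqueChild (proj₂ r) e′ e)
                      (reticulate-edge⇒sameClass r rq′ e′)))

  entry⇝exit : ∀ {y u} → c y ≡ c u → Entry y → Exit u → Path N y u
  entry⇝exit {y} eq en ex with kind y
  ... | tree t = treeWalk⇒path (treeWalk-extend (entry⇒top t en) stay (tree-class t eq))
  ... | reticulate r with star-target (reticulate-class r eq) (proj₁ ∘ proj₂)
  ...   | inj₁ refl = []
  ...   | inj₂ ru   = reticulateWalk⇒path
                        (reticulateWalk-extend (exit⇒bottom ru ex) (reticulate-class r eq) stay)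
  entry⇝exit eq en ex | leaf lf      with refl ← leaf-class lf eq = []
  entry⇝exit eq en ex | redundant rd with refl ← redundant-class rd eq = []

  tree-entry-unique : ∀ {v w} → IsTreeNode N v → Entry v → Entry w → c v ≡ c w → v ≡ w
  tree-entry-unique t env enw eq with star-target (tree-class t eq) (proj₁ ∘ proj₂)
  ... | inj₁ v≡w = v≡w
  ... | inj₂ tw  = top-unique (entry⇒top tw enw)
                     (treeWalk-extend (entry⇒top t env) stay (tree-class t eq))

  reticulate-exit-unique : ∀ {u w} → IsReticulate N u → Exit u → Exit w → c u ≡ c w → u ≡ w
  reticulate-exit-unique r exu exw eq with star-target (reticulate-class r eq) (proj₁ ∘ proj₂)
  ... | inj₁ u≡w = u≡w
  ... | inj₂ rw  = sym (bottom-unique (exit⇒bottom rw exw)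
                     (reticulateWalk-extend (exit⇒bottom r exu) (reticulate-class rw (sym eq)) stay))

  record FirstExit (x w : V) : Set where
    constructor firstExitAt
    field
      {tail head} : V
      edge        : Edge N tail head
      tail∈       : c tail ≡ c x
      head∉       : c head ≢ c x
      before      : Path N x tail
      after       : Path N head w

  firstExit : ∀ {x w} → Path N x w → c x ≢ c w → FirstExit x w
  firstExit [] cx≢cw = ⊥-elim (cx≢cw refl)
  firstExit {x} (_∷_ {v = m} e p) cx≢cw with c m Finₚ.≟ c x
  ... | no cm≢cx = firstExitAt e refl cm≢cx [] p
  ... | yes cm≡cx with firstExitAt e′ cu cv xu vw ← firstExit p (cx≢cw ∘ trans (sym cm≡cx)) =
        firstExitAt e′ (trans cu cm≡cx) (cv ∘ (λ eq → trans eq (sym cm≡cx))) (e ∷ xu) vw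

  lastEntry : ∀ {x w} → Path N x w → c x ≢ c w →
    Σ V λ u → Σ V λ v → c u ≢ c w × c v ≡ c w × Edge N u v
  lastEntry [] cx≢cw = ⊥-elim (cx≢cw refl)
  lastEntry {x} {w} (_∷_ {v = m} e p) cx≢cw with c m Finₚ.≟ c w
  ... | yes cm≡cw = x , m , cx≢cw , cm≡cw , e
  ... | no  cm≢cw = lastEntry p cm≢cw

  Realised : Fin (n H) → Fin (n H) → Set
  Realised a b = Σ V λ u → Σ V λ v → c u ≡ a × c v ≡ b × Edge N u v

  H-edge : ∀ {u v} → Edge N u v → c u ≢ c v → Edge H (c u) (c v)
  H-edge {u} {v} e cu≢cv = proj₂ (c-edge (c u) (c v)) (cu≢cv , u , v , refl , refl , e)

  H-edge⁻¹ : ∀ {a b} → Edge H a b → a ≢ b × Realised a b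
  H-edge⁻¹ {a} {b} = proj₁ (c-edge a b)

  liftPath : ∀ {a b} → Path H a b → ∀ x → c x ≡ a → Entry x →
    Σ V λ y → c y ≡ b × Entry y × Path N x y
  liftPath [] x cx en = x , cx , en , []
  liftPath (he ∷ p) x cx en with H-edge⁻¹ he
  ... | a≢b , u , v , refl , refl , e with liftPath p v refl (u , e , a≢b)
  ...   | y , cy , eny , vy = y , cy , eny , (entry⇝exit cx en (v , e , a≢b ∘ sym) ++ₚ (e ∷ vy))

  compression-acyclic : Acyclic H
  compression-acyclic he p with H-edge⁻¹ he
  ... | a≢b , u , v , refl , refl , e with liftPath p v refl (u , e , a≢b)
  ...   | y , cy , eny , vy = acyclic e (vy ++ₚ entry⇝exit cy eny (v , e , a≢b ∘ sym))

  -- The class of a non-leaf has a child in the compression (follow a path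
  -- to a leaf until it leaves the class); a class other than the root's has
  -- a parent (follow a path from the root).
  nonLeaf⇒H-child : ∀ {v} → ¬ IsLeaf N v → Σ (Fin (n H)) λ b → Edge H (c v) b
  nonLeaf⇒H-child {v} ¬leaf with toLeaf v
  ... | l , lf , p with firstExitAt {u} {w} e cu cw _ _ ← firstExit p (λ eq → ¬leaf (subst (IsLeaf N) (leaf-class lf (sym eq)) lf)) =
    c w , subst (λ z → Edge H z (c w)) cu (H-edge e (λ q → cw (trans (sym q) cu)))

  nonRoot⇒H-parent : ∀ {v} → c v ≢ c root → Σ (Fin (n H)) λ b → Edge H b (c v)
  nonRoot⇒H-parent {v} cv≢cr with lastEntry (fromRoot v) (cv≢cr ∘ sym)
  ... | u , w , cu , cw , e = c u , subst (Edge H (c u)) cw (H-edge e (cu ∘ (λ eq → trans eq cw)))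

  treeEntry⇒H-indeg≡1 : ∀ {x t} → IsTreeNode N t → Edge N x t → c x ≢ c t → indeg H (c t) ≡ 1
  treeEntry⇒H-indeg≡1 {x} {t} tt e cx≢ct = Hᵍ.uniqueParent⇒indeg≡1 (H-edge e cx≢ct) λ b he → only (H-edge⁻¹ he)
    where
    only : ∀ {b} → b ≢ c t × Realised b (c t) → b ≡ c x
    only (b≢ct , u , v , refl , cv , e′) with tree-entry-unique tt (x , e , cx≢ct) (u , e′ , b≢ct ∘ (λ q → trans q cv)) (sym cv)
    ... | refl = cong c (indeg≡1⇒uniqueParent (tree-indeg≡1 tt e) e′ e)

  reticulateExit⇒H-outdeg≡1 : ∀ {s q} → IsReticulate N s → Edge N s q → c q ≢ c s → outdeg H (c s) ≡ 1
  reticulateExit⇒H-outdeg≡1 {s} {q} rs e cq≢cs = Hᵍ.uniqueChild⇒outdeg≡1 (H-edge e (cq≢cs ∘ sym)) λ b he → only (H-edge⁻¹ he)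
    where
    only : ∀ {b} → c s ≢ b × Realised (c s) b → b ≡ c q
    only (cs≢b , u , v , cu , refl , e′) with reticulate-exit-unique rs (q , e , cq≢cs) (v , e′ , cs≢b ∘ (λ z → trans (sym cu) (sym z))) (sym cu)
    ... | refl = cong c (outdeg≡1⇒uniqueChild (proj₂ rs) e′ e)

  lone-indeg≡1 : ∀ {v} → Lone v → indeg N v ≡ 1
  lone-indeg≡1 (inj₁ lf) = proj₁ lf
  lone-indeg≡1 (inj₂ rd) = proj₁ rd

  lone⇒H-indeg≡1 : ∀ {x v} → Lone v → Edge N x v → indeg H (c v) ≡ 1
  lone⇒H-indeg≡1 {x} {v} lone e = Hᵍ.uniqueParent⇒indeg≡1 (H-edge e cx≢cv) λ b he → only (H-edge⁻¹ he)
    where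
    cx≢cv : c x ≢ c v
    cx≢cv eq with refl ← lone-class lone (sym eq) = acyclic e []
    only : ∀ {b} → b ≢ c v × Realised b (c v) → b ≡ c x
    only (_ , u , w , refl , cw , e′) with refl ← lone-class lone (sym cw) =
      cong c (indeg≡1⇒uniqueParent (lone-indeg≡1 lone) e′ e)

  redundant-classChild : ∀ {x v} → IsRedundant N v → Edge N v x → c v ≢ c x
  redundant-classChild rd e eq with refl ← redundant-class rd eq = acyclic e []

  redundant⇒H-outdeg≡1 : ∀ {x v} → IsRedundant N v → Edge N v x → outdeg H (c v) ≡ 1
  redundant⇒H-outdeg≡1 {x} {v} rd e = Hᵍ.uniqueChild⇒outdeg≡1 (H-edge e (redundant-classChild rd e)) λ b he → only (H-edge⁻¹ he)
    where
    only : ∀ {b} → c v ≢ b × Realised (c v) b → b ≡ c x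
    only (_ , u , w , cu , refl , e′) with refl ← redundant-class rd (sym cu) =
      cong c (outdeg≡1⇒uniqueChild (proj₂ rd) e′ e)

  leaf⇒H-outdeg≡0 : ∀ {v} → IsLeaf N v → outdeg H (c v) ≡ 0
  leaf⇒H-outdeg≡0 {v} lf = Hᵍ.noChild⇒outdeg≡0 λ b he → ¬realised (proj₂ (H-edge⁻¹ he))
    where
    ¬realised : ∀ {b} → ¬ Realised (c v) b
    ¬realised (u , w , cu , _ , e′) with refl ← leaf-class lf (sym cu) = leaf-noChild lf e′

  leaf⇒H-leaf : ∀ {v} → IsLeaf N v → IsLeaf H (c v)
  leaf⇒H-leaf lf with x , e ← indeg≢0⇒parent (λ in0 → case trans (sym (proj₁ lf)) in0 of λ ()) =
    lone⇒H-indeg≡1 (inj₁ lf) e , leaf⇒H-outdeg≡0 lf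

  -- The root's class (its tree-node component) is never entered, so it is
  -- the root of the compression.
  rootClass-noEntry : ∀ {x y} → Edge N x y → c y ≡ c root → c x ≢ c y → ⊥
  rootClass-noEntry {x} {y} e cy cx≢cy with kind y
  ... | tree t with treeWalk-extend (entry⇒top t (x , e , cx≢cy)) stay (tree-class t cy)
  ...   | stay         = indeg≡0⇒noParent rootIn0 e
  ...   | step _ e′ _  = indeg≡0⇒noParent rootIn0 e′
  rootClass-noEntry e cy _ | reticulate r with star-target (reticulate-class r cy) (proj₁ ∘ proj₂)
  ... | inj₁ refl = indeg≡0⇒noParent rootIn0 e
  ... | inj₂ rr   = tree⇒¬reticulate root-isTree rr
  rootClass-noEntry e cy _ | leaf lf      with refl ← leaf-class lf cy = indeg≡0⇒noParent rootIn0 e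
  rootClass-noEntry e cy _ | redundant rd with refl ← redundant-class rd cy = indeg≡0⇒noParent rootIn0 e

  H-root-indeg≡0 : IsRoot H (c root)
  H-root-indeg≡0 = Hᵍ.noParent⇒indeg≡0 λ b he → ¬realised (H-edge⁻¹ he)
    where
    ¬realised : ∀ {b} → b ≢ c root × Realised b (c root) → ⊥
    ¬realised (b≢cr , u , w , refl , cw , e′) = rootClass-noEntry e′ cw (b≢cr ∘ (λ q → trans q cw))

  H-root-unique : ∀ a → IsRoot H a → a ≡ c root
  H-root-unique a in0 with u , refl ← c-onto a with c u Finₚ.≟ c root
  ... | yes cu≡cr = cu≡cr
  ... | no  cu≢cr = ⊥-elim (Hᵍ.indeg≡0⇒noParent in0 (proj₂ (nonRoot⇒H-parent cu≢cr)))

  treeClass-entry : ∀ {u} → IsTreeNode N u → c u ≢ c root →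
    Σ V λ v → Σ V λ x → c v ≡ c u × IsTreeNode N v × Edge N x v × c x ≢ c v
  treeClass-entry t cu≢cr with b , he ← nonRoot⇒H-parent cu≢cr with H-edge⁻¹ he
  ... | b≢ , x , v , refl , cv , e = v , x , cv , tree-classmate t (sym cv) , e , (b≢ ∘ (λ q → trans q cv))

  record ComponentExit (u : V) : Set where
    field
      {s q} : V
      s∈    : c s ≡ c u
      s-ret : IsReticulate N s
      edge  : Edge N s q
      q∉    : c q ≢ c s

    exit : Exit s
    exit = q , edge , q∉

  reticulateClass-exit : ∀ {u} → IsReticulate N u → ComponentExit u
  reticulateClass-exit r with b , he ← nonLeaf⇒H-child (λ lf → leaf⇒¬reticulate lf r) with H-edge⁻¹ he
  ... | ≢b , s , q , cs , refl , e = record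
    { s∈ = cs ; s-ret = reticulate-classmate r (sym cs) ; edge = e ; q∉ = λ z → ≢b (trans (sym cs) (sym z)) }

  reticulateClass-H-outdeg≡1 : ∀ {u} → IsReticulate N u → outdeg H (c u) ≡ 1
  reticulateClass-H-outdeg≡1 r = subst (λ z → outdeg H z ≡ 1) s∈ (reticulateExit⇒H-outdeg≡1 s-ret edge q∉)
    where open ComponentExit (reticulateClass-exit r)

  treeClass-H-indeg≡1 : ∀ {u} → IsTreeNode N u → ¬ IsRoot H (c u) → indeg H (c u) ≡ 1
  treeClass-H-indeg≡1 {u} t ¬root with c u Finₚ.≟ c root
  ... | yes cu≡cr = ⊥-elim (¬root (subst (IsRoot H) (sym cu≡cr) H-root-indeg≡0))
  ... | no  cu≢cr with v , x , cv , tv , e , cx≢cv ← treeClass-entry t cu≢cr =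
        subst (λ z → indeg H z ≡ 1) cv (treeEntry⇒H-indeg≡1 tv e cx≢cv)

  redundant⇒H-indeg≡1 : ∀ {u} → IsRedundant N u → indeg H (c u) ≡ 1
  redundant⇒H-indeg≡1 rd with x , e ← indeg≢0⇒parent (λ in0 → case trans (sym (proj₁ rd)) in0 of λ ()) =
    lone⇒H-indeg≡1 (inj₂ rd) e

  nonRootClass-degree : ∀ {u} → ¬ IsRoot H (c u) → Kind u → indeg H (c u) ≡ 1 ⊎ outdeg H (c u) ≡ 1
  nonRootClass-degree ¬root (tree t) = inj₁ (treeClass-H-indeg≡1 t ¬root)
  nonRootClass-degree _ (reticulate r) = inj₂ (reticulateClass-H-outdeg≡1 r)
  nonRootClass-degree _ (leaf lf)      = inj₁ (proj₁ (leaf⇒H-leaf lf))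
  nonRootClass-degree _ (redundant rd) = inj₁ (redundant⇒H-indeg≡1 rd)

  compression-isRPN : IsRPN H (c ∘ ℓ)
  compression-isRPN = record
    { acyclic  = compression-acyclic
    ; root     = c root
    ; rootIn0  = H-root-indeg≡0
    ; rootOut  = Hᵍ.child⇒1≤outdeg (proj₂ (nonLeaf⇒H-child (λ lf → leaf⇒¬tree lf root-isTree)))
    ; rootUniq = H-root-unique
    ; nonRoot  = nonRoot′
    ; ℓ-inj    = λ i j eq → ℓ-inj i j (leaf-class (ℓ-leaf i) eq)
    ; ℓ-leaf   = λ i → leaf⇒H-leaf (ℓ-leaf i)
    ; ℓ-onto   = onto
    }
    where
    nonRoot′ : ∀ a → ¬ IsRoot H a → indeg H a ≡ 1 ⊎ outdeg H a ≡ 1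
    nonRoot′ a ¬root with u , refl ← c-onto a = nonRootClass-degree ¬root (kind u)
    onto : ∀ a → IsLeaf H a → ∃ λ i → c (ℓ i) ≡ a
    onto a (_ , out0) with u , refl ← c-onto a with kind u
    ... | leaf lf with i , ℓi≡u ← ℓ-onto u lf = i , cong c ℓi≡u
    ... | tree t       = ⊥-elim (Hᵍ.outdeg≡0⇒noChild out0 (proj₂ (nonLeaf⇒H-child (λ lf → leaf⇒¬tree lf t))))
    ... | reticulate r = ⊥-elim (Hᵍ.outdeg≡0⇒noChild out0 (proj₂ (nonLeaf⇒H-child (λ lf → leaf⇒¬reticulate lf r))))
    ... | redundant rd = ⊥-elim (Hᵍ.outdeg≡0⇒noChild out0 (proj₂ (nonLeaf⇒H-child (λ lf → leaf⇒¬redundant lf rd))))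

module GalledCompression {k : ℕ} (N : Graph) (ℓ : Fin k → Fin (n N)) (rpn : IsRPN N ℓ)
                         (C : Compression N) (binary : IsBinary N) (galled : IsGalled N) where
  open IsRPN rpn
  open Compression C
  open Digraph N
  open Acyclicity acyclic
  open RPNFacts N ℓ rpn
  open CompressionFacts N ℓ rpn C

  LastNode : ∀ {w v} → Path N w v → V → Set
  LastNode {w} p x = (interior N p ≡ [] × x ≡ w) ⊎ x ∈ interior N p

  lastTreeEdge : ∀ {w v} (p : Path N w v) → IsTreeNode N w →
    (∀ x → x ∈ interior N p → IsTreeNode N x) → w ≢ v →
    Σ V λ x → Edge N x v × Star (TStep N) w x × LastNode p x
  lastTreeEdge []       _ _ w≢v = ⊥-elim (w≢v refl)
  lastTreeEdge {w} (e ∷ []) _ _ _ = w , e , ε , inj₁ (refl , refl)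
  lastTreeEdge {w} (_∷_ {v = m} e (e′ ∷ q)) tw tint _
    with lastTreeEdge (e′ ∷ q) tm (λ x x∈ → tint x (there x∈)) (λ { refl → acyclic e′ q })
    where tm = tint m (here refl)
  ... | x , ex , zs , inj₁ (_ , refl) = x , ex , ((tw , tint m (here refl) , inj₁ e) ◅ zs) , inj₂ (here refl)
  ... | x , ex , zs , inj₂ x∈         = x , ex , ((tw , tint m (here refl) , inj₁ e) ◅ zs) , inj₂ (there x∈)

  disjoint⇒distinctLast : ∀ {w v x₁ x₂} (p q : Path N w v) → InternallyDisjoint N p q →
    LastNode p x₁ → LastNode q x₂ → x₁ ≢ x₂
  disjoint⇒distinctLast p q (_ , notBoth) (inj₁ (ip , _)) (inj₁ (iq , _)) _ = notBoth (ip , iq)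
  disjoint⇒distinctLast {x₁ = x₁} p q (disj , _) (inj₂ m₁) (inj₂ m₂) eq =
    disj x₁ m₁ (subst (_∈ interior N q) (sym eq) m₂)
  disjoint⇒distinctLast p q _ (inj₁ (_ , x₁≡w)) (inj₂ m₂) eq = interior≢start q m₂ (trans (sym eq) x₁≡w)
  disjoint⇒distinctLast p q _ (inj₂ m₁) (inj₁ (_ , x₂≡w)) eq = interior≢start p m₁ (trans eq x₂≡w)

  -- All parents of a reticulate node are tree nodes of one and the same
  -- tree-node component: the two galled paths end in two distinct parents
  -- inside the component of w, and a binary reticulate node has no other.
  reticulate-parents : ∀ {v} → IsReticulate N v →
    Σ V λ w → ∀ z → Edge N z v → IsTreeNode N z × c z ≡ c w
  reticulate-parents {v} r
    with galled v r
  ... | w , tw , _ , p , q , disj , (_ , tp) , (_ , tq)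
    with lastTreeEdge p tw tp (λ { refl → tree⇒¬reticulate tw r })
       | lastTreeEdge q tw tq (λ { refl → tree⇒¬reticulate tw r })
  ... | x₁ , e₁ , zs₁ , last₁ | x₂ , e₂ , zs₂ , last₂ = w , λ z e → inComponent (parents z e)
    where
    parents : ∀ z → Edge N z v → z ≡ x₁ ⊎ z ≡ x₂
    parents z e = indeg≡2⇒oneOf (proj₁ binary v r) (disjoint⇒distinctLast p q disj last₁ last₂) e₁ e₂ e
    reach : ∀ {x} → Star (TStep N) w x → IsTreeNode N x × c x ≡ c w
    reach zs with star-target zs (proj₁ ∘ proj₂)
    ... | inj₁ refl = tw , refl
    ... | inj₂ t    = t , sym (same⇒class (inj₂ (inj₁ zs)))
    inComponent : ∀ {z} → z ≡ x₁ ⊎ z ≡ x₂ → IsTreeNode N z × c z ≡ c w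
    inComponent (inj₁ refl) = reach zs₁
    inComponent (inj₂ refl) = reach zs₂

  -- Hence no two reticulate nodes are adjacent: reticulation components
  -- are single nodes.
  reticulate-alone : ∀ {u v} → IsReticulate N u → c u ≡ c v → u ≡ v
  reticulate-alone r eq with reticulate-class r eq
  ... | ε = refl
  ... | (ru , rm , inj₁ e) ◅ _ = ⊥-elim (tree⇒¬reticulate (proj₁ (proj₂ (reticulate-parents rm) _ e)) ru)
  ... | (ru , rm , inj₂ e) ◅ _ = ⊥-elim (tree⇒¬reticulate (proj₁ (proj₂ (reticulate-parents ru) _ e)) rm)

  -- The class of a reticulate node has in-degree 1: every edge into it
  -- comes from the one tree-node component containing all its parents.
  reticulate⇒H-indeg≡1 : ∀ {u} → IsReticulate N u → ¬ IsRoot H (c u) → indeg H (c u) ≡ 1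
  reticulate⇒H-indeg≡1 {u} r ¬root with c u Finₚ.≟ c root
  ... | yes cu≡cr = ⊥-elim (¬root (subst (IsRoot H) (sym cu≡cr) H-root-indeg≡0))
  ... | no  cu≢cr with b , he ← nonRoot⇒H-parent cu≢cr with H-edge⁻¹ he
  ... | b≢cu , x , v , refl , cv , e with refl ← reticulate-alone r (sym cv) =
    Hᵍ.uniqueParent⇒indeg≡1 (H-edge e b≢cu) λ b′ he′ → fromComponent (H-edge⁻¹ he′)
    where
    fromComponent : ∀ {b′} → b′ ≢ c u × Realised b′ (c u) → b′ ≡ c x
    fromComponent (_ , y , w , refl , cw , e′) with refl ← reticulate-alone r (sym cw) =
      trans (proj₂ (proj₂ (reticulate-parents r) y e′)) (sym (proj₂ (proj₂ (reticulate-parents r) x e)))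

  compression-isTree : IsTree H (c ∘ ℓ)
  compression-isTree = compression-isRPN , indeg≡1
    where
    indeg≡1 : ∀ a → ¬ IsRoot H a → indeg H a ≡ 1
    indeg≡1 a ¬root with u , refl ← c-onto a with kind u
    ... | tree t       = treeClass-H-indeg≡1 t ¬root
    ... | reticulate r = reticulate⇒H-indeg≡1 r ¬root
    ... | leaf lf      = proj₁ (leaf⇒H-leaf lf)
    ... | redundant rd = redundant⇒H-indeg≡1 rd

module VisibleCompression {k : ℕ} (N : Graph) (ℓ : Fin k → Fin (n N)) (rpn : IsRPN N ℓ)
                          (C : Compression N) (visible : IsReticulationVisible N) where
  open IsRPN rpn
  open Compression C
  open Digraph N
  open Acyclicity acyclic
  open RPNFacts N ℓ rpn
  open CompressionFacts N ℓ rpn C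

  Dominates : V → V → Set
  Dominates z w = ∀ r → IsRoot N r → (p : Path N r w) → z ∈ nodes N p

  dominates-between : ∀ {z w x} → Dominates z w → Path N z x → Path N x w → Dominates z x
  dominates-between dom z⇝x x⇝w r isRoot p with ∈-++ₚ p x⇝w (dom r isRoot (p ++ₚ x⇝w))
  ... | inj₁ z∈p = z∈p
  ... | inj₂ z∈q with refl ← path-antisym z⇝x (prefix x⇝w z∈q) = end∈ p

  path-viaChild : ∀ {x v l} → outdeg N x ≡ 1 → Edge N x v → x ≢ l → Path N x l → Path N v l
  path-viaChild _    _ x≢l []       = ⊥-elim (x≢l refl)
  path-viaChild {l = l} out1 e _ (e′ ∷ p) = subst (λ z → Path N z l) (outdeg≡1⇒uniqueChild out1 e′ e) p

  dominates-viaChild : ∀ {x v l} → outdeg N x ≡ 1 → Edge N x v → x ≢ l → Dominates x l → Dominates v l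
  dominates-viaChild {x} out1 e x≢l dom r isRoot p with suffix p (dom r isRoot p)
  ... | []       , _   = ⊥-elim (x≢l refl)
  ... | (e′ ∷ q) , sub = sub _ (there (subst (_∈ nodes N q) (outdeg≡1⇒uniqueChild out1 e′ e) (start∈ q)))

  -- Paths through a reticulation component R with exit s (by the in-tree
  -- structure, s is the only exit): every node of R reaches s, every path
  -- leaving R goes through s, and therefore no path leaving R re-enters it.
  module ReticulationComponent {s : V} (rs : IsReticulate N s) (ex : Exit s) where

    exit-reached : ∀ {y} → c y ≡ c s → Path N y s
    exit-reached {y} cy with l , lf , p ← toLeaf y
      with firstExit p (λ q → leaf⇒¬reticulate lf (subst (IsReticulate N) (sym (leaf-class lf (sym q)))
                                                    (reticulate-classmate rs (sym cy))))
    ... | firstExitAt e′ cs′ cq′ y⇝s′ _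
      with refl ← reticulate-exit-unique rs ex (_ , e′ , cq′ ∘ (λ z → trans z cs′)) (trans (sym cy) (sym cs′)) = y⇝s′

    leave-viaExit : ∀ {x w} → c x ≡ c s → c w ≢ c s → Path N x w → Path N s w
    leave-viaExit cx cw≢cs p with firstExit p (λ q → cw≢cs (trans (sym q) cx))
    ... | firstExitAt e′ cs′ cq′ _ q′⇝w
      with refl ← reticulate-exit-unique rs ex (_ , e′ , cq′ ∘ (λ z → trans z cs′)) (trans (sym cx) (sym cs′)) = e′ ∷ q′⇝w

    no-reentry : ∀ {x p y} → c x ≡ c s → Path N x p → Edge N p y → c y ≡ c s → c p ≢ c s → ⊥
    no-reentry cx x⇝p e cy cp≢cs =
      cp≢cs (cong c (sym (path-antisym (leave-viaExit cx cp≢cs x⇝p) (e ∷ exit-reached cy))))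

    -- If d lies outside R, reaches s and dominates s, then the tail p of
    -- every edge entering R is reachable from d: a root path through that
    -- edge must meet d before entering R.
    entry-belowDominator : ∀ {d p y} → c d ≢ c s → Path N d s → Dominates d s →
      Path N root p → Edge N p y → c y ≡ c s → Path N d p
    entry-belowDominator {d} cd≢cs d⇝s dom r⇝p e cy
      with ∈-++ₚ r⇝p (e ∷ exit-reached cy) (dom root rootIn0 (r⇝p ++ₚ (e ∷ exit-reached cy)))
    ... | inj₁ d∈ = proj₁ (suffix r⇝p d∈)
    ... | inj₂ (here refl) = []
    ... | inj₂ (there d∈) =
      ⊥-elim (cd≢cs (cong c (path-antisym d⇝s (leave-viaExit cy cd≢cs (prefix (exit-reached cy) d∈)))))

  module ReticulationComponentOf {v : V} (rv : IsReticulate N v) where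
    open ComponentExit (reticulateClass-exit rv) public using (s; s∈; s-ret)
    open ComponentExit (reticulateClass-exit rv) using (exit)
    open ReticulationComponent s-ret exit public

  Good : Fin (n H) → Set
  Good b = IsLeaf H b ⊎ IsTreeNode H b ⊎ IsRedundant H b

  GoodChild : Fin (n H) → Set
  GoodChild a = Σ (Fin (n H)) λ b → Edge H a b × Good b

  reticulateClass-redundant : ∀ {v} → IsReticulate N v → indeg H (c v) ≡ 1 → IsRedundant H (c v)
  reticulateClass-redundant r in1 = in1 , reticulateClass-H-outdeg≡1 r

  -- A class entered by an edge and not a reticulation component has
  -- in-degree 1, so it is a leaf, a redundant node or a tree node of the
  -- compression.
  entered-nonReticulate-good : ∀ {x v} → Edge N x v → c x ≢ c v → ¬ IsReticulate N v → Good (c v)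
  entered-nonReticulate-good {v = v} e cx≢cv ¬ret with kind v
  ... | reticulate r = ⊥-elim (¬ret r)
  ... | leaf lf      = inj₁ (leaf⇒H-leaf lf)
  ... | redundant rd with y , e′ ← outdeg≢0⇒child {v} (λ out0 → case trans (sym (proj₂ rd)) out0 of λ ()) =
    inj₂ (inj₂ (lone⇒H-indeg≡1 (inj₂ rd) e , redundant⇒H-outdeg≡1 rd e′))
  ... | tree t with b , he ← nonLeaf⇒H-child {v} (λ lf → leaf⇒¬tree lf t)
    with m≤n⇒m<n∨m≡n (Hᵍ.child⇒1≤outdeg he)
  ...   | inj₁ 2≤out = inj₂ (inj₁ (inj₂ (treeEntry⇒H-indeg≡1 t e cx≢cv , 2≤out)))
  ...   | inj₂ 1≡out = inj₂ (inj₂ (treeEntry⇒H-indeg≡1 t e cx≢cv , sym 1≡out))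

  -- A reticulation component: its exit edge leads to a non-reticulate node.
  reticulateClass-goodChild : ∀ {u} → IsReticulate N u → GoodChild (c u)
  reticulateClass-goodChild r =
    c q , subst (λ z → Edge H z (c q)) s∈ (H-edge edge (q∉ ∘ sym)) ,
    entered-nonReticulate-good edge (q∉ ∘ sym) (λ rq → q∉ (sym (reticulate-edge⇒sameClass s-ret rq edge)))
    where open ComponentExit (reticulateClass-exit r)


  module RedundantAboveReticulation {u v : V} (rd : IsRedundant N u) (e : Edge N u v) (rv : IsReticulate N v) where
    open ReticulationComponentOf rv

    cu≢cs : c u ≢ c s
    cu≢cs cu≡cs = redundant⇒¬reticulate rd (subst (IsReticulate N) (sym (redundant-class rd cu≡cs)) s-ret)

    u⇝s : Path N u s
    u⇝s = e ∷ exit-reached (sym s∈)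

    u-dominates-s : Dominates u s
    u-dominates-s = viaLeaf (visible u (inj₂ rd))
      where
      viaLeaf : Visible N u → Dominates u s
      viaLeaf (l , lf , u⇝l , dom) =
        dominates-between dom u⇝s (leave-viaExit (sym s∈) cl≢cs (path-viaChild (proj₂ rd) e u≢l u⇝l))
        where
        u≢l : u ≢ l
        u≢l refl = leaf⇒¬redundant lf rd
        cl≢cs : c l ≢ c s
        cl≢cs cl≡cs = leaf⇒¬reticulate lf (subst (IsReticulate N) (sym (leaf-class lf cl≡cs)) s-ret)

    entry-fromU : ∀ {p y} → Edge N p y → c y ≡ c v → c p ≢ c v → p ≡ u
    entry-fromU {p} e′ cy cp≢cv = tailIsU (entry-belowDominator cu≢cs u⇝s u-dominates-s (fromRoot p) e′ (trans cy (sym s∈)))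
      where
      tailIsU : Path N u p → p ≡ u
      tailIsU []         = refl
      tailIsU (e₂ ∷ u⇝p) = ⊥-elim (no-reentry (sym s∈) (subst (λ z → Path N z p) (outdeg≡1⇒uniqueChild (proj₂ rd) e₂ e) u⇝p)
                                              e′ (trans cy (sym s∈)) (cp≢cv ∘ (λ q → trans q s∈)))

    reticulateChild-H-indeg≡1 : indeg H (c v) ≡ 1
    reticulateChild-H-indeg≡1 =
      Hᵍ.uniqueParent⇒indeg≡1 (H-edge e (redundant-classChild rd e)) λ b he → fromU (H-edge⁻¹ he)
      where
      fromU : ∀ {b} → b ≢ c v × Realised b (c v) → b ≡ c u
      fromU (b≢cv , p , y , refl , cy , e′) = cong c (entry-fromU e′ cy b≢cv)

  redundant-goodChild : ∀ {u} → IsRedundant N u → GoodChild (c u)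
  redundant-goodChild {u} rd with v , e ← outdeg≢0⇒child {u} (λ out0 → case trans (sym (proj₂ rd)) out0 of λ ())
    with reticulate? v
  ... | no ¬rv = c v , H-edge e (redundant-classChild rd e) , entered-nonReticulate-good e (redundant-classChild rd e) ¬rv
  ... | yes rv = c v , H-edge e (redundant-classChild rd e) ,
                 inj₂ (inj₂ (reticulateClass-redundant rv (RedundantAboveReticulation.reticulateChild-H-indeg≡1 rd e rv)))

  module TreeComponent {z : V} (tz : IsTreeNode N z) where

    record Escape (w : V) : Set where
      constructor escape
      field
        {u₁ v₁}   : V
        leaving   : Edge N u₁ v₁
        u₁∈T      : c u₁ ≡ c z
        v₁∉T      : c v₁ ≢ c z
        z⇝u₁      : Path N z u₁
        v₁⇝w      : Path N v₁ w
        dominates : Dominates z w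
        separated : IsReticulate N v₁ → c v₁ ≢ c w

      cu₁≢cv₁ : c u₁ ≢ c v₁
      cu₁≢cv₁ q = v₁∉T (trans (sym q) u₁∈T)

      T→v₁ : Edge H (c z) (c v₁)
      T→v₁ = subst (λ a → Edge H a (c v₁)) u₁∈T (H-edge leaving cu₁≢cv₁)

    -- If the edge (p,y) enters the component of v₁ from outside T, then z
    -- reaches p (it dominates the exit s of that component), and leaving T
    -- on the way from z to p gives an escape towards s, an ancestor of w.
    escape-again : ∀ {w} (esc : Escape w) → IsReticulate N (Escape.v₁ esc) → ∀ {p y} →
      Edge N p y → c y ≡ c (Escape.v₁ esc) → c p ≢ c z → c p ≢ c (Escape.v₁ esc) →
      Σ V λ s → s ⇝⁺ w × Escape s
    escape-again {w} (escape leaving u₁∈T v₁∉T z⇝u₁ v₁⇝w dom sep) rv {p} e′ cy cp≢cz cp≢cv₁ =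
      s , path⇒⇝⁺ s⇝w s≢w ,
      escape e₂ cu₂ cv₂ z⇝u₂ (v₂⇝p ++ₚ (e′ ∷ exit-reached cy′)) (dominates-between dom z⇝s s⇝w)
             (λ _ cv₂≡cs → no-reentry cv₂≡cs v₂⇝p e′ cy′ cp≢cs)
      where
      open ReticulationComponentOf rv
      cy′ : c _ ≡ c s
      cy′ = trans cy (sym s∈)
      cp≢cs : c p ≢ c s
      cp≢cs = cp≢cv₁ ∘ (λ q → trans q s∈)
      cw≢cs : c w ≢ c s
      cw≢cs q = sep rv (sym (trans q s∈))
      s⇝w : Path N s w
      s⇝w = leave-viaExit (sym s∈) cw≢cs v₁⇝w
      s≢w : s ≢ w
      s≢w refl = cw≢cs refl
      z⇝s : Path N z s
      z⇝s = z⇝u₁ ++ₚ (leaving ∷ exit-reached (sym s∈))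
      z⇝p : Path N z p
      z⇝p = entry-belowDominator (v₁∉T ∘ (λ q → trans (sym s∈) (sym q))) z⇝s
              (dominates-between dom z⇝s s⇝w) (fromRoot p) e′ cy′
      open FirstExit (firstExit z⇝p (cp≢cz ∘ sym)) renaming (edge to e₂; tail∈ to cu₂; head∉ to cv₂; before to z⇝u₂; after to v₂⇝p)

    escape-step : ∀ {w} → Escape w → GoodChild (c z) ⊎ Σ V λ s → s ⇝⁺ w × Escape s
    escape-step esc = byKind (reticulate? v₁)
      where
      open Escape esc
      byKind : Dec (IsReticulate N v₁) → GoodChild (c z) ⊎ Σ V λ s → s ⇝⁺ _ × Escape s
      byKind (no ¬rv) = inj₁ (c v₁ , T→v₁ , entered-nonReticulate-good leaving cu₁≢cv₁ ¬rv)
      byKind (yes rv) with indeg H (c v₁) ≟ 1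
      ... | yes in1 = inj₁ (c v₁ , T→v₁ , inj₂ (inj₂ (reticulateClass-redundant rv in1)))
      ... | no ¬in1 with b , b≢cu₁ , he ← Hᵍ.indeg≢1⇒otherParent ¬in1 (H-edge leaving cu₁≢cv₁)
        with H-edge⁻¹ he
      ...   | b≢cv₁ , p , y , refl , cy , e′ =
        inj₂ (escape-again esc rv e′ cy (λ q → b≢cu₁ (trans q (sym u₁∈T))) b≢cv₁)

    escape⇒goodChild : ∀ {w} → Acc _⇝⁺_ w → Escape w → GoodChild (c z)
    escape⇒goodChild (acc rec) esc with escape-step esc
    ... | inj₁ good             = good
    ... | inj₂ (s , s⇝⁺w , esc′) = escape⇒goodChild (rec s⇝⁺w) esc′

    dominatingLeaf⇒goodChild : ∀ {l} → IsLeaf N l → Path N z l → Dominates z l → GoodChild (c z)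
    dominatingLeaf⇒goodChild {l} lf z⇝l dom =
      escape⇒goodChild (ancestors-wf l) (escape edge tail∈ head∉ before after dom separated)
      where
      cz≢cl : c z ≢ c l
      cz≢cl q = leaf⇒¬tree lf (subst (IsTreeNode N) (sym (leaf-class lf (sym q))) tz)
      separated : ∀ {v} → IsReticulate N v → c v ≢ c l
      separated rv q = leaf⇒¬reticulate lf (subst (IsReticulate N) (sym (leaf-class lf (sym q))) rv)
      open FirstExit (firstExit z⇝l cz≢cl)

  -- Every tree-node component has a good child: the root dominates every
  -- leaf, and the top v of any other component has a visible parent x of
  -- out-degree 1, whose domination of a leaf passes on to v.
  treeClass-goodChild : ∀ {u} → IsTreeNode N u → GoodChild (c u)
  treeClass-goodChild {u} t with c u Finₚ.≟ c root
  ... | yes cu≡cr with l , lf , r⇝l ← toLeaf root =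
    subst GoodChild (sym cu≡cr) (TreeComponent.dominatingLeaf⇒goodChild root-isTree lf r⇝l rootDominates)
    where
    rootDominates : Dominates root l
    rootDominates r isRoot q = subst (_∈ nodes N q) (rootUniq r isRoot) (start∈ q)
  ... | no cu≢cr with v , x , cv , tv , e , cx≢cv ← treeClass-entry t cu≢cr =
    subst GoodChild cv (fromVisibleParent (parentKind (kind x)))
    where
    parentKind : Kind x → IsReticulate N x ⊎ IsRedundant N x
    parentKind (tree tx)       = ⊥-elim (cx≢cv (tree-edge⇒sameClass tx tv e))
    parentKind (reticulate rx) = inj₁ rx
    parentKind (leaf lf)       = ⊥-elim (leaf-noChild lf e)
    parentKind (redundant rd)  = inj₂ rd
    fromVisibleParent : IsReticulate N x ⊎ IsRedundant N x → GoodChild (c v)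
    fromVisibleParent k with l , lf , x⇝l , dom ← visible x k =
      TreeComponent.dominatingLeaf⇒goodChild tv lf
        (path-viaChild out1 e x≢l x⇝l) (dominates-viaChild out1 e x≢l dom)
      where
      out1 : outdeg N x ≡ 1
      out1 = [ proj₂ , proj₂ ]′ k
      x≢l : x ≢ l
      x≢l refl = [ leaf⇒¬reticulate lf , leaf⇒¬redundant lf ]′ k

  compression-isTreeChild : IsTreeChild H (c ∘ ℓ)
  compression-isTreeChild = compression-isRPN , goodChild
    where
    goodChild : TreeChildProp H
    goodChild a ¬leaf with u , refl ← c-onto a with kind u
    ... | tree t       = treeClass-goodChild t
    ... | reticulate r = reticulateClass-goodChild r
    ... | leaf lf      = ⊥-elim (¬leaf (leaf⇒H-leaf lf))
    ... | redundant rd = redundant-goodChild rd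

theorem3p1 : ∀ {k : ℕ} (N : Graph) (ℓ : Fin k → Fin (n N)) → IsRPN N ℓ →
    (C : Compression N) →
      ((IsBinary N → IsGalled N →
          IsTree (Compression.H C) (Compression.c C ∘ ℓ))
      × (IsReticulationVisible N →
          IsTreeChild (Compression.H C) (Compression.c C ∘ ℓ)))
theorem3p1 N ℓ rpn C =
  (λ binary galled → GalledCompression.compression-isTree N ℓ rpn C binary galled) ,
  (λ visible → VisibleCompression.compression-isTreeChild N ℓ rpn C visible)
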